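{- For every integer $k\ge2$, $$\sum_{n\ge1}x^n\sum_{w\in\mathcal F_{n,k}}\mathrm{ver}(G(w))=\frac{10x-9x^2-3(1+k)x^k-(4-3k)x^{k+1}+8x^{k+2}-2x^{2k+2}}{(1-2x+x^{k+1})^2}$$ and $$\sum_{n\ge1}x^n\sum_{w\in\mathcal F_{n,k}}\mathrm{edg}(G(w))=\frac{11x-5x^2-(2+5k)x^k-(9-5k)x^{k+1}+4x^{k+2}+2x^{2k+1}-x^{2k+2}}{(1-2x+x^{k+1})^2}.$$
   Context: For integers $k\ge 2$, $n\ge1$, $\mathcal F_{n,k}$ is the set of binary words $w=w_1\cdots w_n$ with no $k$ consecutive $1$'s. $P(w)$ is the bargraph polyomino formed by the unit squares $[i-1,i]\times[j-1,j]$, $1\le i\le n$, $1\le j\le w_i+1$. $G(w)$ is the graph whose vertices are the corners of the cells of $P(w)$ and whose edges are the cell sides. $\mathrm{ver}(G)$ and $\mathrm{edg}(G)$ denote the numbers of vertices and edges of $G$. -}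

module Defs where

open import Data.Bool using (Bool; true; false; _∧_; _∨_; not; if_then_else_)
open import Data.Nat as ℕ using (ℕ; zero; suc; _≤ᵇ_)
open import Data.List using (List; []; _∷_; map; filter; length; upTo; concatMap)
open import Data.Nat.ListAction using (sum)
open import Data.Bool using (T?)
open import Data.Integer as ℤ using (ℤ; +_; -_)
open import Data.Product using (_×_; _,_)
open import Relation.Nullary.Decidable using (does)
open import Relation.Binary.PropositionalEquality using (_≡_)
open import Data.Nat using (_≟_)

-- All binary words of length n (true = 1, false = 0).
words : ℕ → List (List Bool)
words zero    = [] ∷ []
words (suc n) = concatMap (λ w → (false ∷ w) ∷ (true ∷ w) ∷ []) (words n)

-- noRunAux k r w : the word w, preceded by a current run of r ones,
-- never reaches k consecutive ones.
noRunAux : ℕ → ℕ → List Bool → Bool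
noRunAux k r []           = true
noRunAux k r (false ∷ ws) = noRunAux k 0 ws
noRunAux k r (true ∷ ws)  = if k ≤ᵇ suc r then false else noRunAux k (suc r) ws

noKOnes : ℕ → List Bool → Bool
noKOnes k w = noRunAux k 0 w

F : ℕ → ℕ → List (List Bool)
F n k = filter (λ w → T? (noKOnes k w)) (words n)

-- height of column i (1-indexed): w_i + 1; 0 outside 1..n
height : List Bool → ℕ → ℕ
height []       _             = 0
height (b ∷ w)  zero          = 0
height (b ∷ w)  (suc zero)    = if b then 2 else 1
height (b ∷ w)  (suc (suc i)) = height w (suc i)

-- cell [i-1,i] × [j-1,j] belongs to P(w)
cell : List Bool → ℕ → ℕ → Bool
cell w i j = (1 ≤ᵇ i) ∧ (1 ≤ᵇ j) ∧ (j ≤ᵇ height w i)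

isVertex : List Bool → ℕ → ℕ → Bool
isVertex w a b = cell w a b ∨ cell w (suc a) b ∨ cell w a (suc b) ∨ cell w (suc a) (suc b)

-- horizontal unit segment [a,a+1] × {b} is a side of some cell
isHEdge : List Bool → ℕ → ℕ → Bool
isHEdge w a b = cell w (suc a) b ∨ cell w (suc a) (suc b)

-- vertical unit segment {a} × [b,b+1] is a side of some cell
isVEdge : List Bool → ℕ → ℕ → Bool
isVEdge w a b = cell w a (suc b) ∨ cell w (suc a) (suc b)

count2 : ℕ → ℕ → (ℕ → ℕ → Bool) → ℕ
count2 A B p = sum (map (λ a → length (filter (λ b → T? (p a b)) (upTo (suc B)))) (upTo (suc A)))

-- All corners/sides of cells lie in [0,n] × [0,3] (cells have height ≤ 2),
-- so these counts are exactly the numbers of vertices and edges of G(w).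
ver : List Bool → ℕ
ver w = count2 (length w) 3 (isVertex w)

edg : List Bool → ℕ
edg w = count2 (length w) 3 (isHEdge w) ℕ.+ count2 (length w) 3 (isVEdge w)

Series : Set
Series = ℕ → ℤ

poly : List (ℤ × ℕ) → Series
poly []             n = + 0
poly ((c , e) ∷ ts) n = (if does (e ≟ n) then c else + 0) ℤ.+ poly ts n

_⊛_ : Series → Series → Series
(f ⊛ g) n = Data.List.foldr ℤ._+_ (+ 0) (map (λ i → f i ℤ.* g (n ℕ.∸ i)) (upTo (suc n)))
  where import Data.List

genF : (List Bool → ℕ) → ℕ → Series
genF stat k zero    = + 0
genF stat k (suc n) = + sum (map stat (F (suc n) k))

base : ℕ → Series
base k = poly ((+ 1 , 0) ∷ (- (+ 2) , 1) ∷ (+ 1 , suc k) ∷ [])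

den : ℕ → Series
den k = base k ⊛ base k

numVer : ℕ → Series
numVer k = poly ( (+ 10 , 1) ∷ (- (+ 9) , 2) ∷ (- (+ 3 ℤ.* (+ 1 ℤ.+ + k)) , k)
                ∷ (- (+ 4 ℤ.- + 3 ℤ.* + k) , suc k) ∷ (+ 8 , suc (suc k))
                ∷ (- (+ 2) , suc (suc (k ℕ.+ k))) ∷ [])

numEdg : ℕ → Series
numEdg k = poly ( (+ 11 , 1) ∷ (- (+ 5) , 2) ∷ (- (+ 2 ℤ.+ + 5 ℤ.* + k) , k)
                ∷ (- (+ 9 ℤ.- + 5 ℤ.* + k) , suc k) ∷ (+ 4 , suc (suc k))
                ∷ (+ 2 , suc (k ℕ.+ k)) ∷ (- (+ 1) , suc (suc (k ℕ.+ k))) ∷ [])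

module Submission where

-- Both statistics are sums, over the vertical lines x = 0, …, n, of a quantity depending only on
-- the heights of the two columns beside the line.  Words without k consecutive 1's are read by an
-- automaton whose state d is the number of 1's that may still follow; the generating functions of
-- the accepted words, plain and weighted by such a line sum, satisfy linear recurrences in d that
-- unroll into the sums 1 + x + ⋯ + x^(m-1) and x + 2x² + ⋯ + m x^m.  Multiplying by 1 - x removes
-- these sums, and eliminating the remaining unknowns in the ring of formal power series gives
-- B·C = 1 - x^k for the count C, and a closed form of B²·W for the weighted sum W, where
-- B = 1 - 2x + x^(k+1) is the square root of the denominator.

open import Defs
open import Data.Nat using (ℕ; _≤_)
open import Data.Product using (_×_)
open import Relation.Binary.PropositionalEquality using (_≡_)

open import Algebra.Bundles using (CommutativeRing)
import Algebra.Properties.CommutativeSemigroup as CommSemigroupProperties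
import Algebra.Solver.Ring
open import Algebra.Solver.Ring.AlmostCommutativeRing
  using (AlmostCommutativeRing; _-Raw-AlmostCommutative⟶_; fromCommutativeRing)
open import Data.Bool using (Bool; true; false; if_then_else_; T; T?; _∧_; _∨_)
open import Data.Integer as ℤ using (ℤ; +_)
import Data.Integer.Properties as ℤₚ
open import Data.Integer.Tactic.RingSolver using (solve-∀)
open import Data.List using (List; []; _∷_; map; foldr; upTo; applyUpTo; concatMap; filter; length)
open import Data.List.Properties using (map-cong; filter-≐)
import Data.Maybe as Maybe
open import Data.Nat as ℕ using (zero; suc; _∸_; _≟_; _≤ᵇ_)
open import Data.Nat.ListAction using (sum)
import Data.Nat.Properties as ℕₚ
open import Data.Product using (_,_)
open import Function using (_∘_; id)
open import Relation.Binary.PropositionalEquality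
  using (refl; sym; trans; cong; cong₂; subst; module ≡-Reasoning)
open import Relation.Nullary.Decidable using (does; dec⇒maybe)

private
  module ℤ+ = CommSemigroupProperties ℤₚ.+-commutativeSemigroup
  module ℕ+ = CommSemigroupProperties ℕₚ.+-commutativeSemigroup

sumℤ : List ℤ → ℤ
sumℤ = foldr ℤ._+_ (+ 0)

module _ {A : Set} where

  sumℤ-map-zero : (xs : List A) → sumℤ (map (λ _ → + 0) xs) ≡ + 0
  sumℤ-map-zero []       = refl
  sumℤ-map-zero (_ ∷ xs) = trans (ℤₚ.+-identityˡ _) (sumℤ-map-zero xs)

  sumℤ-map-+ : ∀ (f g : A → ℤ) xs →
               sumℤ (map (λ x → f x ℤ.+ g x) xs) ≡ sumℤ (map f xs) ℤ.+ sumℤ (map g xs)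
  sumℤ-map-+ f g []       = refl
  sumℤ-map-+ f g (x ∷ xs) = trans (cong (ℤ._+_ (f x ℤ.+ g x)) (sumℤ-map-+ f g xs))
                                  (ℤ+.interchange (f x) (g x) _ _)

  sumℤ-map-*ˡ : ∀ c (f : A → ℤ) xs → sumℤ (map (λ x → c ℤ.* f x) xs) ≡ c ℤ.* sumℤ (map f xs)
  sumℤ-map-*ˡ c f []       = sym (ℤₚ.*-zeroʳ c)
  sumℤ-map-*ˡ c f (x ∷ xs) = trans (cong (ℤ._+_ (c ℤ.* f x)) (sumℤ-map-*ˡ c f xs))
                                   (sym (ℤₚ.*-distribˡ-+ c (f x) _))

  map-applyUpTo : ∀ {B : Set} (h : A → B) (f : ℕ → A) m → map h (applyUpTo f m) ≡ applyUpTo (h ∘ f) m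
  map-applyUpTo h f zero    = refl
  map-applyUpTo h f (suc m) = cong (h (f 0) ∷_) (map-applyUpTo h (f ∘ suc) m)

  sumℤ-filter : ∀ (p : A → Bool) (st : A → ℕ) xs →
    + sum (map st (filter (λ w → T? (p w)) xs)) ≡ sumℤ (map (λ w → if p w then + st w else + 0) xs)
  sumℤ-filter p st []       = refl
  sumℤ-filter p st (w ∷ ws) with p w
  ... | true  = cong (ℤ._+_ (+ st w)) (sumℤ-filter p st ws)
  ... | false = trans (sumℤ-filter p st ws) (sym (ℤₚ.+-identityˡ _))

map-upTo-suc : ∀ {A : Set} (h : ℕ → A) m → map h (upTo (suc m)) ≡ h 0 ∷ map (h ∘ suc) (upTo m)
map-upTo-suc h m = cong (h 0 ∷_) (trans (map-applyUpTo h suc m) (sym (map-applyUpTo (h ∘ suc) id m)))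

-- Formal power series

infix  4 _≈ˢ_
infixl 6 _+ˢ_ _-ˢ_
infixl 7 _*ˢ_
infix  8 -ˢ_

_≈ˢ_ : Series → Series → Set
f ≈ˢ g = ∀ n → f n ≡ g n

_+ˢ_ : Series → Series → Series
(f +ˢ g) n = f n ℤ.+ g n

-ˢ_ : Series → Series
(-ˢ f) n = ℤ.- f n

_-ˢ_ : Series → Series → Series
f -ˢ g = f +ˢ -ˢ g

const : ℤ → Series
const c zero    = c
const c (suc n) = + 0

-- The Cauchy product with a fixity, so that products associate to the left.
_*ˢ_ : Series → Series → Series
f *ˢ g = f ⊛ g

-- 0ˢ is const (+ 0) rather than λ _ → + 0 so that it is literally the solver's constant 0.
0ˢ 1ˢ : Series
0ˢ = const (+ 0)
1ˢ = const (+ 1)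

0ˢ-coeff : ∀ n → 0ˢ n ≡ + 0
0ˢ-coeff zero    = refl
0ˢ-coeff (suc n) = refl

tail : Series → Series
tail f n = f (suc n)

⊛-at-zero : ∀ f g → (f ⊛ g) 0 ≡ f 0 ℤ.* g 0
⊛-at-zero f g = ℤₚ.+-identityʳ _

⊛-at-suc : ∀ f g n → (f ⊛ g) (suc n) ≡ f 0 ℤ.* g (suc n) ℤ.+ (tail f ⊛ g) n
⊛-at-suc f g n = cong sumℤ (map-upTo-suc (λ i → f i ℤ.* g (suc n ∸ i)) (suc n))

⊛-cong : ∀ {f f′ g g′} → f ≈ˢ f′ → g ≈ˢ g′ → f ⊛ g ≈ˢ f′ ⊛ g′
⊛-cong f≈f′ g≈g′ n = cong sumℤ (map-cong (λ i → cong₂ ℤ._*_ (f≈f′ i) (g≈g′ (n ∸ i))) (upTo (suc n)))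

⊛-distribʳ : ∀ f g h → (f +ˢ g) ⊛ h ≈ˢ f ⊛ h +ˢ g ⊛ h
⊛-distribʳ f g h n =
  trans (cong sumℤ (map-cong (λ i → ℤₚ.*-distribʳ-+ (h (n ∸ i)) (f i) (g i)) (upTo (suc n))))
        (sumℤ-map-+ (λ i → f i ℤ.* h (n ∸ i)) (λ i → g i ℤ.* h (n ∸ i)) (upTo (suc n)))

⊛-scaleˡ : ∀ c f g n → ((λ m → c ℤ.* f m) ⊛ g) n ≡ c ℤ.* (f ⊛ g) n
⊛-scaleˡ c f g n =
  trans (cong sumℤ (map-cong (λ i → ℤₚ.*-assoc c (f i) (g (n ∸ i))) (upTo (suc n))))
        (sumℤ-map-*ˡ c (λ i → f i ℤ.* g (n ∸ i)) (upTo (suc n)))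

const-⊛ : ∀ c g → const c ⊛ g ≈ˢ (λ n → c ℤ.* g n)
const-⊛ c g zero    = ⊛-at-zero (const c) g
const-⊛ c g (suc n) = begin
  (const c ⊛ g) (suc n)                      ≡⟨ ⊛-at-suc (const c) g n ⟩
  c ℤ.* g (suc n) ℤ.+ (tail (const c) ⊛ g) n ≡⟨ cong (ℤ._+_ (c ℤ.* g (suc n))) (sumℤ-map-zero (upTo (suc n))) ⟩
  c ℤ.* g (suc n) ℤ.+ + 0                    ≡⟨ ℤₚ.+-identityʳ _ ⟩
  c ℤ.* g (suc n)                            ∎
  where open ≡-Reasoning

⊛-identityˡ : ∀ g → 1ˢ ⊛ g ≈ˢ g
⊛-identityˡ g n = trans (const-⊛ (+ 1) g n) (ℤₚ.*-identityˡ (g n))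

⊛-comm : ∀ f g → f ⊛ g ≈ˢ g ⊛ f
⊛-comm f g zero          = trans (⊛-at-zero f g) (trans (ℤₚ.*-comm (f 0) (g 0)) (sym (⊛-at-zero g f)))
⊛-comm f g (suc zero)    = begin
  (f ⊛ g) 1                             ≡⟨ ⊛-at-suc f g 0 ⟩
  f 0 ℤ.* g 1 ℤ.+ (f 1 ℤ.* g 0 ℤ.+ + 0) ≡⟨ cong (ℤ._+_ (f 0 ℤ.* g 1)) (ℤₚ.+-identityʳ _) ⟩
  f 0 ℤ.* g 1 ℤ.+ f 1 ℤ.* g 0           ≡⟨ cong₂ ℤ._+_ (ℤₚ.*-comm (f 0) (g 1)) (ℤₚ.*-comm (f 1) (g 0)) ⟩
  g 1 ℤ.* f 0 ℤ.+ g 0 ℤ.* f 1           ≡⟨ ℤₚ.+-comm (g 1 ℤ.* f 0) _ ⟩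
  g 0 ℤ.* f 1 ℤ.+ g 1 ℤ.* f 0           ≡⟨ cong (ℤ._+_ (g 0 ℤ.* f 1)) (sym (ℤₚ.+-identityʳ _)) ⟩
  g 0 ℤ.* f 1 ℤ.+ (g 1 ℤ.* f 0 ℤ.+ + 0) ≡⟨ sym (⊛-at-suc g f 0) ⟩
  (g ⊛ f) 1                             ∎
  where open ≡-Reasoning
⊛-comm f g (suc (suc n)) = begin
  (f ⊛ g) (2 ℕ.+ n)                                         ≡⟨ ⊛-at-suc f g (suc n) ⟩
  f 0 ℤ.* g (2 ℕ.+ n) ℤ.+ (tail f ⊛ g) (suc n)              ≡⟨ cong (ℤ._+_ (f 0 ℤ.* g (2 ℕ.+ n))) (trans (⊛-comm (tail f) g (suc n)) (⊛-at-suc g (tail f) n)) ⟩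
  f 0 ℤ.* g (2 ℕ.+ n) ℤ.+ (g 0 ℤ.* f (2 ℕ.+ n) ℤ.+ (tail g ⊛ tail f) n)
    ≡⟨ cong (λ t → f 0 ℤ.* g (2 ℕ.+ n) ℤ.+ (g 0 ℤ.* f (2 ℕ.+ n) ℤ.+ t)) (⊛-comm (tail g) (tail f) n) ⟩
  f 0 ℤ.* g (2 ℕ.+ n) ℤ.+ (g 0 ℤ.* f (2 ℕ.+ n) ℤ.+ (tail f ⊛ tail g) n)
    ≡⟨ ℤ+.x∙yz≈y∙xz (f 0 ℤ.* g (2 ℕ.+ n)) (g 0 ℤ.* f (2 ℕ.+ n)) ((tail f ⊛ tail g) n) ⟩
  g 0 ℤ.* f (2 ℕ.+ n) ℤ.+ (f 0 ℤ.* g (2 ℕ.+ n) ℤ.+ (tail f ⊛ tail g) n)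
    ≡⟨ cong (ℤ._+_ (g 0 ℤ.* f (2 ℕ.+ n))) (sym (trans (⊛-comm (tail g) f (suc n)) (⊛-at-suc f (tail g) n))) ⟩
  g 0 ℤ.* f (2 ℕ.+ n) ℤ.+ (tail g ⊛ f) (suc n)              ≡⟨ sym (⊛-at-suc g f (suc n)) ⟩
  (g ⊛ f) (2 ℕ.+ n)                                         ∎
  where open ≡-Reasoning

⊛-assoc : ∀ f g h → (f ⊛ g) ⊛ h ≈ˢ f ⊛ (g ⊛ h)
⊛-assoc f g h zero = begin
  ((f ⊛ g) ⊛ h) 0           ≡⟨ ⊛-at-zero (f ⊛ g) h ⟩
  (f ⊛ g) 0 ℤ.* h 0         ≡⟨ cong (ℤ._* h 0) (⊛-at-zero f g) ⟩
  f 0 ℤ.* g 0 ℤ.* h 0       ≡⟨ ℤₚ.*-assoc (f 0) (g 0) (h 0) ⟩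
  f 0 ℤ.* (g 0 ℤ.* h 0)     ≡⟨ cong (f 0 ℤ.*_) (sym (⊛-at-zero g h)) ⟩
  f 0 ℤ.* (g ⊛ h) 0         ≡⟨ sym (⊛-at-zero f (g ⊛ h)) ⟩
  (f ⊛ (g ⊛ h)) 0           ∎
  where open ≡-Reasoning
⊛-assoc f g h (suc n) = begin
  ((f ⊛ g) ⊛ h) (suc n)
    ≡⟨ ⊛-at-suc (f ⊛ g) h n ⟩
  (f ⊛ g) 0 ℤ.* h (suc n) ℤ.+ (tail (f ⊛ g) ⊛ h) n
    ≡⟨ cong₂ ℤ._+_ (cong (ℤ._* h (suc n)) (⊛-at-zero f g)) (⊛-cong {f′ = (λ m → f 0 ℤ.* tail g m) +ˢ tail f ⊛ g} {h} {h} (⊛-at-suc f g) (λ _ → refl) n) ⟩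
  f 0 ℤ.* g 0 ℤ.* h (suc n) ℤ.+ (((λ m → f 0 ℤ.* tail g m) +ˢ tail f ⊛ g) ⊛ h) n
    ≡⟨ cong (ℤ._+_ (f 0 ℤ.* g 0 ℤ.* h (suc n))) (⊛-distribʳ (λ m → f 0 ℤ.* tail g m) (tail f ⊛ g) h n) ⟩
  f 0 ℤ.* g 0 ℤ.* h (suc n) ℤ.+ (((λ m → f 0 ℤ.* tail g m) ⊛ h) n ℤ.+ ((tail f ⊛ g) ⊛ h) n)
    ≡⟨ cong (λ t → f 0 ℤ.* g 0 ℤ.* h (suc n) ℤ.+ t) (cong₂ ℤ._+_ (⊛-scaleˡ (f 0) (tail g) h n) (⊛-assoc (tail f) g h n)) ⟩
  f 0 ℤ.* g 0 ℤ.* h (suc n) ℤ.+ (f 0 ℤ.* (tail g ⊛ h) n ℤ.+ (tail f ⊛ (g ⊛ h)) n)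
    ≡⟨ rearrange (f 0) (g 0) (h (suc n)) _ _ ⟩
  f 0 ℤ.* (g 0 ℤ.* h (suc n) ℤ.+ (tail g ⊛ h) n) ℤ.+ (tail f ⊛ (g ⊛ h)) n
    ≡⟨ cong (λ t → f 0 ℤ.* t ℤ.+ (tail f ⊛ (g ⊛ h)) n) (sym (⊛-at-suc g h n)) ⟩
  f 0 ℤ.* (g ⊛ h) (suc n) ℤ.+ (tail f ⊛ (g ⊛ h)) n
    ≡⟨ sym (⊛-at-suc f (g ⊛ h) n) ⟩
  (f ⊛ (g ⊛ h)) (suc n)
    ∎
  where
  open ≡-Reasoning
  rearrange : ∀ a b c d e → a ℤ.* b ℤ.* c ℤ.+ (a ℤ.* d ℤ.+ e) ≡ a ℤ.* (b ℤ.* c ℤ.+ d) ℤ.+ e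
  rearrange a b c d e = begin
    a ℤ.* b ℤ.* c ℤ.+ (a ℤ.* d ℤ.+ e)   ≡⟨ sym (ℤₚ.+-assoc (a ℤ.* b ℤ.* c) (a ℤ.* d) e) ⟩
    a ℤ.* b ℤ.* c ℤ.+ a ℤ.* d ℤ.+ e     ≡⟨ cong (λ t → t ℤ.+ a ℤ.* d ℤ.+ e) (ℤₚ.*-assoc a b c) ⟩
    a ℤ.* (b ℤ.* c) ℤ.+ a ℤ.* d ℤ.+ e   ≡⟨ cong (ℤ._+ e) (sym (ℤₚ.*-distribˡ-+ a (b ℤ.* c) d)) ⟩
    a ℤ.* (b ℤ.* c ℤ.+ d) ℤ.+ e         ∎

⊛-distribˡ : ∀ f g h → f ⊛ (g +ˢ h) ≈ˢ f ⊛ g +ˢ f ⊛ h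
⊛-distribˡ f g h n = begin
  (f ⊛ (g +ˢ h)) n            ≡⟨ ⊛-comm f (g +ˢ h) n ⟩
  ((g +ˢ h) ⊛ f) n            ≡⟨ ⊛-distribʳ g h f n ⟩
  (g ⊛ f) n ℤ.+ (h ⊛ f) n     ≡⟨ cong₂ ℤ._+_ (⊛-comm g f n) (⊛-comm h f n) ⟩
  (f ⊛ g) n ℤ.+ (f ⊛ h) n     ∎
  where open ≡-Reasoning

seriesCommutativeRing : CommutativeRing _ _
seriesCommutativeRing = record
  { Carrier = Series
  ; _≈_ = _≈ˢ_
  ; _+_ = _+ˢ_
  ; _*_ = _⊛_
  ; -_ = -ˢ_
  ; 0# = 0ˢ
  ; 1# = 1ˢ
  ; isCommutativeRing = record
    { isRing = record
      { +-isAbelianGroup = record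
        { isGroup = record
          { isMonoid = record
            { isSemigroup = record
              { isMagma = record
                { isEquivalence = record
                  { refl = λ _ → refl ; sym = λ p n → sym (p n) ; trans = λ p q n → trans (p n) (q n) }
                ; ∙-cong = λ p q n → cong₂ ℤ._+_ (p n) (q n) }
              ; assoc = λ f g h n → ℤₚ.+-assoc (f n) (g n) (h n) }
            ; identity = (λ f n → trans (cong (ℤ._+ f n) (0ˢ-coeff n)) (ℤₚ.+-identityˡ (f n)))
                       , (λ f n → trans (cong (ℤ._+_ (f n)) (0ˢ-coeff n)) (ℤₚ.+-identityʳ (f n))) }
          ; inverse = (λ f n → trans (ℤₚ.+-inverseˡ (f n)) (sym (0ˢ-coeff n)))
                    , (λ f n → trans (ℤₚ.+-inverseʳ (f n)) (sym (0ˢ-coeff n)))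
          ; ⁻¹-cong = λ p n → cong ℤ.-_ (p n) }
        ; comm = λ f g n → ℤₚ.+-comm (f n) (g n) }
      ; *-cong = ⊛-cong
      ; *-assoc = ⊛-assoc
      ; *-identity = ⊛-identityˡ , (λ f n → trans (⊛-comm f 1ˢ n) (⊛-identityˡ f n))
      ; distrib = ⊛-distribˡ , (λ h f g → ⊛-distribʳ f g h) }
    ; *-comm = ⊛-comm } }

open CommutativeRing seriesCommutativeRing public
  using () renaming (refl to ≈ˢ-refl; sym to ≈ˢ-sym; trans to ≈ˢ-trans; +-cong to +ˢ-cong)

seriesAlmostCommutativeRing : AlmostCommutativeRing _ _
seriesAlmostCommutativeRing = fromCommutativeRing seriesCommutativeRing

const-+ : ∀ a b → const (a ℤ.+ b) ≈ˢ const a +ˢ const b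
const-+ a b zero    = refl
const-+ a b (suc n) = refl

const-* : ∀ a b → const (a ℤ.* b) ≈ˢ const a *ˢ const b
const-* a b n = sym (trans (const-⊛ a (const b) n) (scale-const n))
  where
  scale-const : ∀ n → a ℤ.* const b n ≡ const (a ℤ.* b) n
  scale-const zero    = refl
  scale-const (suc n) = ℤₚ.*-zeroʳ a

const-neg : ∀ a → const (ℤ.- a) ≈ˢ -ˢ const a
const-neg a zero    = refl
const-neg a (suc n) = refl

const-suc : ∀ {a b} → a ≡ suc b → const (+ a) ≈ˢ 1ˢ +ˢ const (+ b)
const-suc {b = b} refl = const-+ (+ 1) (+ b)

const-≡ : ∀ {a b} → a ≡ b → const (+ a) ≈ˢ const (+ b)
const-≡ refl = ≈ˢ-refl

const-affine : ∀ {c} a b K → c ≡ a ℤ.+ b ℤ.* + K → const c ≈ˢ const a +ˢ const b *ˢ const (+ K)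
const-affine a b K refl = ≈ˢ-trans (const-+ a (b ℤ.* + K)) (+ˢ-cong (≈ˢ-refl {const a}) (const-* b (+ K)))

constMorphism : CommutativeRing.rawRing ℤₚ.+-*-commutativeRing -Raw-AlmostCommutative⟶ seriesAlmostCommutativeRing
constMorphism = record
  { ⟦_⟧    = const
  ; +-homo = const-+
  ; *-homo = const-*
  ; -‿homo = const-neg
  ; 0-homo = λ _ → refl
  ; 1-homo = λ _ → refl
  }

module SeriesSolver = Algebra.Solver.Ring (CommutativeRing.rawRing ℤₚ.+-*-commutativeRing)
  seriesAlmostCommutativeRing constMorphism
  (λ a b → Maybe.map (λ a≡b n → cong (λ c → const c n) a≡b) (dec⇒maybe (a ℤ.≟ b)))

open SeriesSolver using (solve; _:=_; con; _:+_; _:-_; _:*_; :-_)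

-- Each elimination below adds multiples of hypotheses a ≈ b and finishes with one ring identity.
linear-combination : ∀ {l r a b} c → a ≈ˢ b → l ≈ˢ r +ˢ c *ˢ (a -ˢ b) → l ≈ˢ r
linear-combination {r = r} {b = b} c a≈b l≈ = ≈ˢ-trans l≈ (≈ˢ-trans
  (+ˢ-cong (≈ˢ-refl {r}) (⊛-cong (≈ˢ-refl {c}) (+ˢ-cong a≈b (≈ˢ-refl { -ˢ b}))))
  (solve 3 (λ r c b → r :+ c :* (b :- b) := r) (λ _ → refl) r c b))

X : Series
X zero    = + 0
X (suc n) = 1ˢ n

X^ : ℕ → Series
X^ zero    = 1ˢ
X^ (suc m) = X *ˢ X^ m

X⊛-at-suc : ∀ f n → (X ⊛ f) (suc n) ≡ f n
X⊛-at-suc f n = trans (⊛-at-suc X f n) (trans (ℤₚ.+-identityˡ _) (⊛-identityˡ f n))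

≈ˢ-const+X* : ∀ {f g} a → f 0 ≡ a → tail f ≈ˢ g → f ≈ˢ const a +ˢ X *ˢ g
≈ˢ-const+X* a f0≡a tail≈ zero    = trans f0≡a (sym (ℤₚ.+-identityʳ a))
≈ˢ-const+X* {g = g} a f0≡a tail≈ (suc n) = trans (tail≈ n) (sym (trans (ℤₚ.+-identityˡ _) (X⊛-at-suc g n)))

X^-coeff : ∀ e n → X^ e n ≡ (if does (e ≟ n) then + 1 else + 0)
X^-coeff zero    zero    = refl
X^-coeff zero    (suc n) = refl
X^-coeff (suc e) zero    = ⊛-at-zero X (X^ e)
X^-coeff (suc e) (suc n) = trans (X⊛-at-suc (X^ e) n) (X^-coeff e n)

X^-+ : ∀ a b → X^ (a ℕ.+ b) ≈ˢ X^ a *ˢ X^ b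
X^-+ zero    b = ≈ˢ-sym (⊛-identityˡ (X^ b))
X^-+ (suc a) b = ≈ˢ-trans (⊛-cong (≈ˢ-refl {X}) (X^-+ a b)) (≈ˢ-sym (⊛-assoc X (X^ a) (X^ b)))

polySum : List (ℤ × ℕ) → Series
polySum []             = 0ˢ
polySum ((c , e) ∷ ts) = const c *ˢ X^ e +ˢ polySum ts

poly≈polySum : ∀ ts → poly ts ≈ˢ polySum ts
poly≈polySum []             n = sym (0ˢ-coeff n)
poly≈polySum ((c , e) ∷ ts) n = cong₂ ℤ._+_ (sym (begin
  (const c ⊛ X^ e) n                          ≡⟨ const-⊛ c (X^ e) n ⟩
  c ℤ.* X^ e n                                ≡⟨ cong (c ℤ.*_) (X^-coeff e n) ⟩
  c ℤ.* (if does (e ≟ n) then + 1 else + 0)   ≡⟨ scale (does (e ≟ n)) ⟩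
  (if does (e ≟ n) then c else + 0)           ∎)) (poly≈polySum ts n)
  where
  open ≡-Reasoning
  scale : ∀ b → c ℤ.* (if b then + 1 else + 0) ≡ (if b then c else + 0)
  scale true  = ℤₚ.*-identityʳ c
  scale false = ℤₚ.*-zeroʳ c

geometric : ℕ → Series
geometric zero    = 0ˢ
geometric (suc m) = 1ˢ +ˢ X *ˢ geometric m

arithGeometric : ℕ → Series
arithGeometric zero    = 0ˢ
arithGeometric (suc m) = X *ˢ (geometric (suc m) +ˢ arithGeometric m)

geometric-formula : ∀ m → (1ˢ -ˢ X) *ˢ geometric m ≈ˢ 1ˢ -ˢ X^ m
geometric-formula zero    =
  solve 1 (λ x → (con (+ 1) :- x) :* con (+ 0) := con (+ 1) :- con (+ 1)) (λ _ → refl) X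
geometric-formula (suc m) = linear-combination X (geometric-formula m)
  (solve 3 (λ x g p →
      (con (+ 1) :- x) :* (con (+ 1) :+ x :* g)
    := con (+ 1) :- x :* p :+ x :* ((con (+ 1) :- x) :* g :- (con (+ 1) :- p)))
    (λ _ → refl) X (geometric m) (X^ m))

arithGeometric-formula : ∀ m →
  (1ˢ -ˢ X) *ˢ arithGeometric m ≈ˢ X *ˢ geometric m -ˢ const (+ m) *ˢ X *ˢ X^ m
arithGeometric-formula zero    =
  solve 1 (λ x → (con (+ 1) :- x) :* con (+ 0) := x :* con (+ 0) :- con (+ 0) :* x :* con (+ 1))
    (λ _ → refl) X
arithGeometric-formula (suc m) =
  linear-combination (X *ˢ X) (geometric-formula m)
  (linear-combination X (arithGeometric-formula m)
  (linear-combination (X *ˢ X *ˢ X^ m) (const-+ (+ 1) (+ m))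
  (solve 6 (λ x g a p cm cm+1 →
      (con (+ 1) :- x) :* (x :* ((con (+ 1) :+ x :* g) :+ a))
    := x :* (con (+ 1) :+ x :* g) :- cm+1 :* x :* (x :* p)
       :+ x :* x :* ((con (+ 1) :- x) :* g :- (con (+ 1) :- p))
       :+ x :* ((con (+ 1) :- x) :* a :- (x :* g :- cm :* x :* p))
       :+ x :* x :* p :* (cm+1 :- (con (+ 1) :+ cm)))
    (λ _ → refl) X (geometric m) (arithGeometric m) (X^ m) (const (+ m)) (const (+ suc m)))))

-- Words without k consecutive 1's

sumℤ-words-suc : ∀ (φ : List Bool → ℤ) n →
  sumℤ (map φ (words (suc n))) ≡
  sumℤ (map (φ ∘ (false ∷_)) (words n)) ℤ.+ sumℤ (map (φ ∘ (true ∷_)) (words n))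
sumℤ-words-suc φ n = go (words n)
  where
  branch : List Bool → List (List Bool)
  branch w = (false ∷ w) ∷ (true ∷ w) ∷ []
  go : ∀ ws → sumℤ (map φ (concatMap branch ws)) ≡
              sumℤ (map (φ ∘ (false ∷_)) ws) ℤ.+ sumℤ (map (φ ∘ (true ∷_)) ws)
  go []       = refl
  go (w ∷ ws) = begin
    a ℤ.+ (b ℤ.+ sumℤ (map φ (concatMap branch ws))) ≡⟨ cong (λ r → a ℤ.+ (b ℤ.+ r)) (go ws) ⟩
    a ℤ.+ (b ℤ.+ (p ℤ.+ q))                    ≡⟨ cong (ℤ._+_ a) (ℤ+.x∙yz≈y∙xz b p q) ⟩
    a ℤ.+ (p ℤ.+ (b ℤ.+ q))                    ≡⟨ sym (ℤₚ.+-assoc a p (b ℤ.+ q)) ⟩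
    a ℤ.+ p ℤ.+ (b ℤ.+ q)                      ∎
    where
    open ≡-Reasoning
    a b p q : ℤ
    a = φ (false ∷ w)
    b = φ (true ∷ w)
    p = sumℤ (map (φ ∘ (false ∷_)) ws)
    q = sumℤ (map (φ ∘ (true ∷_)) ws)

-- In state d at most d further 1's may be read before the next 0, which resets the state to K.
accepts : ℕ → ℕ → List Bool → Bool
accepts K d       []          = true
accepts K d       (false ∷ w) = accepts K K w
accepts K zero    (true ∷ w)  = false
accepts K (suc d) (true ∷ w)  = accepts K d w

+-<ᵇ-suc : ∀ r d → (r ℕ.+ d ℕ.<ᵇ suc r) ≡ (d ℕ.≤ᵇ 0)
+-<ᵇ-suc zero    zero    = refl
+-<ᵇ-suc zero    (suc d) = refl
+-<ᵇ-suc (suc r) d       = +-<ᵇ-suc r d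

noRunAux≡accepts : ∀ r d w → noRunAux (suc (r ℕ.+ d)) r w ≡ accepts (r ℕ.+ d) d w
noRunAux≡accepts r d       []          = refl
noRunAux≡accepts r d       (false ∷ w) = noRunAux≡accepts 0 (r ℕ.+ d) w
noRunAux≡accepts r zero    (true ∷ w)  rewrite +-<ᵇ-suc r 0 = refl
noRunAux≡accepts r (suc d) (true ∷ w)  rewrite +-<ᵇ-suc r (suc d) | ℕₚ.+-suc r d =
  noRunAux≡accepts (suc r) d w

noKOnes≡accepts : ∀ K w → noKOnes (suc K) w ≡ accepts K K w
noKOnes≡accepts K = noRunAux≡accepts 0 K

-- Vertices and edges counted line by line

columnHeight : Bool → ℕ
columnHeight b = if b then 2 else 1

heightFrom : ℕ → List Bool → ℕ → ℕ
heightFrom p w       zero    = p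
heightFrom p []      (suc i) = 0
heightFrom p (b ∷ w) (suc i) = heightFrom (columnHeight b) w i

heightFrom-suc : ∀ p q w i → heightFrom p w (suc i) ≡ heightFrom q w (suc i)
heightFrom-suc p q []      i = refl
heightFrom-suc p q (b ∷ w) i = refl

height≡heightFrom : ∀ w i → height w i ≡ heightFrom 0 w i
height≡heightFrom []      zero          = refl
height≡heightFrom []      (suc i)       = refl
height≡heightFrom (b ∷ w) zero          = refl
height≡heightFrom (b ∷ w) (suc zero)    = refl
height≡heightFrom (b ∷ w) (suc (suc i)) =
  trans (height≡heightFrom w (suc i)) (heightFrom-suc 0 (columnHeight b) w i)

pairSum : (ℕ → ℕ → ℕ) → ℕ → List Bool → ℕ
pairSum G p []      = G p 0
pairSum G p (b ∷ w) = G p (columnHeight b) ℕ.+ pairSum G (columnHeight b) w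

sum-heightPairs≡pairSum : ∀ G p w →
  sum (map (λ a → G (heightFrom p w a) (heightFrom p w (suc a))) (upTo (suc (length w)))) ≡ pairSum G p w
sum-heightPairs≡pairSum G p []      = ℕₚ.+-identityʳ _
sum-heightPairs≡pairSum G p (b ∷ w) =
  trans (cong sum (map-upTo-suc (λ a → G (heightFrom p (b ∷ w) a) (heightFrom p (b ∷ w) (suc a))) (suc (length w))))
        (cong (G p (columnHeight b) ℕ.+_) (sum-heightPairs≡pairSum G (columnHeight b) w))

pairSum-+ : ∀ G H p w → pairSum G p w ℕ.+ pairSum H p w ≡ pairSum (λ a b → G a b ℕ.+ H a b) p w
pairSum-+ G H p []      = refl
pairSum-+ G H p (b ∷ w) = begin
  G p h ℕ.+ pairSum G h w ℕ.+ (H p h ℕ.+ pairSum H h w)   ≡⟨ ℕ+.interchange (G p h) _ _ _ ⟩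
  G p h ℕ.+ H p h ℕ.+ (pairSum G h w ℕ.+ pairSum H h w)   ≡⟨ cong (G p h ℕ.+ H p h ℕ.+_) (pairSum-+ G H h w) ⟩
  G p h ℕ.+ H p h ℕ.+ pairSum (λ a b → G a b ℕ.+ H a b) h w ∎
  where
  open ≡-Reasoning
  h : ℕ
  h = columnHeight b

cellOfHeight : ℕ → ℕ → Bool
cellOfHeight h j = (1 ≤ᵇ j) ∧ (j ≤ᵇ h)

cell≡cellOfHeight : ∀ w i j → cell w i j ≡ cellOfHeight (height w i) j
cell≡cellOfHeight []      zero    zero    = refl
cell≡cellOfHeight []      zero    (suc j) = refl
cell≡cellOfHeight (b ∷ w) zero    zero    = refl
cell≡cellOfHeight (b ∷ w) zero    (suc j) = refl
cell≡cellOfHeight w       (suc i) j       = refl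

pointsOnLine : (ℕ → ℕ → ℕ → Bool) → ℕ → ℕ → ℕ
pointsOnLine Q h₁ h₂ = length (filter (λ b → T? (Q h₁ h₂ b)) (upTo 4))

count2≡pairSum : ∀ (P : ℕ → ℕ → Bool) Q w →
  (∀ a b → P a b ≡ Q (height w a) (height w (suc a)) b) →
  count2 (length w) 3 P ≡ pairSum (pointsOnLine Q) 0 w
count2≡pairSum P Q w P≡Q = trans (cong sum (map-cong onLine (upTo (suc (length w)))))
                                 (sum-heightPairs≡pairSum (pointsOnLine Q) 0 w)
  where
  onLine : ∀ a → length (filter (λ b → T? (P a b)) (upTo 4)) ≡ pointsOnLine Q (heightFrom 0 w a) (heightFrom 0 w (suc a))
  onLine a = trans (cong length (filter-≐ (λ b → T? (P a b)) (λ b → T? (Q _ _ b))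
                                  ((λ {b} → subst T (P≡Q a b)) , (λ {b} → subst T (sym (P≡Q a b))))
                                  (upTo 4)))
                   (cong₂ (pointsOnLine Q) (height≡heightFrom w a) (height≡heightFrom w (suc a)))

vertexOnLine horizontalEdgeOnLine verticalEdgeOnLine : ℕ → ℕ → ℕ → Bool
vertexOnLine h₁ h₂ b =
  cellOfHeight h₁ b ∨ cellOfHeight h₂ b ∨ cellOfHeight h₁ (suc b) ∨ cellOfHeight h₂ (suc b)
horizontalEdgeOnLine h₁ h₂ b = cellOfHeight h₂ b ∨ cellOfHeight h₂ (suc b)
verticalEdgeOnLine h₁ h₂ b = cellOfHeight h₁ (suc b) ∨ cellOfHeight h₂ (suc b)

verticesAt edgesAt : ℕ → ℕ → ℕ
verticesAt = pointsOnLine vertexOnLine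
edgesAt h₁ h₂ = pointsOnLine horizontalEdgeOnLine h₁ h₂ ℕ.+ pointsOnLine verticalEdgeOnLine h₁ h₂

ver≡pairSum : ∀ w → ver w ≡ pairSum verticesAt 0 w
ver≡pairSum w = count2≡pairSum (isVertex w) vertexOnLine w λ a b →
  cong₂ _∨_ (cell≡cellOfHeight w a b) (cong₂ _∨_ (cell≡cellOfHeight w (suc a) b)
    (cong₂ _∨_ (cell≡cellOfHeight w a (suc b)) (cell≡cellOfHeight w (suc a) (suc b))))

edg≡pairSum : ∀ w → edg w ≡ pairSum edgesAt 0 w
edg≡pairSum w = trans (cong₂ ℕ._+_
  (count2≡pairSum (isHEdge w) horizontalEdgeOnLine w λ a b →
    cong₂ _∨_ (cell≡cellOfHeight w (suc a) b) (cell≡cellOfHeight w (suc a) (suc b)))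
  (count2≡pairSum (isVEdge w) verticalEdgeOnLine w λ a b →
    cong₂ _∨_ (cell≡cellOfHeight w a (suc b)) (cell≡cellOfHeight w (suc a) (suc b))))
  (pairSum-+ (pointsOnLine horizontalEdgeOnLine) (pointsOnLine verticalEdgeOnLine) 0 w)

-- Generating functions of the automaton states

module StateSeries (K : ℕ) (G : ℕ → ℕ → ℕ) where

  acceptedSum : ℕ → (List Bool → ℤ) → Series
  acceptedSum d f n = sumℤ (map (λ w → if accepts K d w then f w else + 0) (words n))

  acceptedSum-at-zero : ∀ d f → acceptedSum d f 0 ≡ f []
  acceptedSum-at-zero d f = ℤₚ.+-identityʳ (f [])

  acceptedSum-zero-suc : ∀ f n → acceptedSum 0 f (suc n) ≡ acceptedSum K (f ∘ (false ∷_)) n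
  acceptedSum-zero-suc f n = begin
    acceptedSum 0 f (suc n)
      ≡⟨ sumℤ-words-suc (λ w → if accepts K 0 w then f w else + 0) n ⟩
    acceptedSum K (f ∘ (false ∷_)) n ℤ.+ sumℤ (map (λ _ → + 0) (words n))
      ≡⟨ cong (ℤ._+_ (acceptedSum K (f ∘ (false ∷_)) n)) (sumℤ-map-zero (words n)) ⟩
    acceptedSum K (f ∘ (false ∷_)) n ℤ.+ + 0
      ≡⟨ ℤₚ.+-identityʳ _ ⟩
    acceptedSum K (f ∘ (false ∷_)) n ∎
    where open ≡-Reasoning

  acceptedSum-zero : ∀ f → acceptedSum 0 f ≈ˢ const (f []) +ˢ X *ˢ acceptedSum K (f ∘ (false ∷_))
  acceptedSum-zero f = ≈ˢ-const+X* (f []) (acceptedSum-at-zero 0 f) (acceptedSum-zero-suc f)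

  acceptedSum-suc : ∀ d f → acceptedSum (suc d) f ≈ˢ acceptedSum 0 f +ˢ X *ˢ acceptedSum d (f ∘ (true ∷_))
  acceptedSum-suc d f zero    = sym (ℤₚ.+-identityʳ _)
  acceptedSum-suc d f (suc n) = begin
    acceptedSum (suc d) f (suc n)
      ≡⟨ sumℤ-words-suc (λ w → if accepts K (suc d) w then f w else + 0) n ⟩
    acceptedSum K (f ∘ (false ∷_)) n ℤ.+ acceptedSum d (f ∘ (true ∷_)) n
      ≡⟨ cong₂ ℤ._+_ (sym (acceptedSum-zero-suc f n)) (sym (X⊛-at-suc (acceptedSum d (f ∘ (true ∷_))) n)) ⟩
    (acceptedSum 0 f +ˢ X *ˢ acceptedSum d (f ∘ (true ∷_))) (suc n) ∎
    where open ≡-Reasoning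

  count : ℕ → Series
  count d = acceptedSum d (λ _ → + 1)

  acceptedSum-+ : ∀ d c (g : List Bool → ℕ) →
    acceptedSum d (λ w → + (c ℕ.+ g w)) ≈ˢ const (+ c) *ˢ count d +ˢ acceptedSum d (λ w → + g w)
  acceptedSum-+ d c g n = begin
    acceptedSum d (λ w → + (c ℕ.+ g w)) n
      ≡⟨ cong sumℤ (map-cong (λ w → split (accepts K d w) (g w)) (words n)) ⟩
    sumℤ (map (λ w → + c ℤ.* indicator w ℤ.+ (if accepts K d w then + g w else + 0)) (words n))
      ≡⟨ sumℤ-map-+ (λ w → + c ℤ.* indicator w) _ (words n) ⟩
    sumℤ (map (λ w → + c ℤ.* indicator w) (words n)) ℤ.+ acceptedSum d (λ w → + g w) n
      ≡⟨ cong (ℤ._+ acceptedSum d (λ w → + g w) n)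
              (trans (sumℤ-map-*ˡ (+ c) indicator (words n)) (sym (const-⊛ (+ c) (count d) n))) ⟩
    (const (+ c) *ˢ count d +ˢ acceptedSum d (λ w → + g w)) n ∎
    where
    open ≡-Reasoning
    indicator : List Bool → ℤ
    indicator w = if accepts K d w then + 1 else + 0
    split : ∀ b s → (if b then + (c ℕ.+ s) else + 0) ≡ + c ℤ.* (if b then + 1 else + 0) ℤ.+ (if b then + s else + 0)
    split true  s = cong (ℤ._+ + s) (sym (ℤₚ.*-identityʳ (+ c)))
    split false s = sym (trans (ℤₚ.+-identityʳ _) (ℤₚ.*-zeroʳ (+ c)))

  weight : ℕ → ℕ → Series
  weight d p = acceptedSum d (λ w → + pairSum G p w)

  count-zero : count 0 ≈ˢ 1ˢ +ˢ X *ˢ count K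
  count-zero = acceptedSum-zero (λ _ → + 1)

  count-suc : ∀ d → count (suc d) ≈ˢ count 0 +ˢ X *ˢ count d
  count-suc d = acceptedSum-suc d (λ _ → + 1)

  weight-zero : ∀ p → weight 0 p ≈ˢ const (+ G p 0) +ˢ X *ˢ (const (+ G p 1) *ˢ count K +ˢ weight K 1)
  weight-zero p = ≈ˢ-trans (acceptedSum-zero _)
    (+ˢ-cong (≈ˢ-refl {const (+ G p 0)}) (⊛-cong (≈ˢ-refl {X}) (acceptedSum-+ K (G p 1) (pairSum G 1))))

  weight-suc : ∀ d p → weight (suc d) p ≈ˢ weight 0 p +ˢ X *ˢ (const (+ G p 2) *ˢ count d +ˢ weight d 2)
  weight-suc d p = ≈ˢ-trans (acceptedSum-suc d _)
    (+ˢ-cong (≈ˢ-refl {weight 0 p}) (⊛-cong (≈ˢ-refl {X}) (acceptedSum-+ d (G p 2) (pairSum G 2))))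

  count-closed : ∀ d → count d ≈ˢ geometric (suc d) *ˢ count 0
  count-closed zero    =
    solve 2 (λ x u → u := (con (+ 1) :+ x :* con (+ 0)) :* u) (λ _ → refl) X (count 0)
  count-closed (suc d) = ≈ˢ-trans (count-suc d) (linear-combination X (count-closed d)
    (solve 4 (λ x u c g → u :+ x :* c := (con (+ 1) :+ x :* g) :* u :+ x :* (c :- g :* u))
      (λ _ → refl) X (count 0) (count d) (geometric (suc d))))

  weight₂-closed : ∀ d →
    weight d 2 ≈ˢ geometric (suc d) *ˢ weight 0 2 +ˢ const (+ G 2 2) *ˢ arithGeometric d *ˢ count 0
  weight₂-closed zero    =
    solve 4 (λ x w t u → w := (con (+ 1) :+ x :* con (+ 0)) :* w :+ t :* con (+ 0) :* u)
      (λ _ → refl) X (weight 0 2) (const (+ G 2 2)) (count 0)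
  weight₂-closed (suc d) = ≈ˢ-trans (weight-suc d 2)
    (linear-combination X (weight₂-closed d)
    (linear-combination (X *ˢ const (+ G 2 2)) (count-closed d)
    (solve 8 (λ x w₀ t c w g a u →
        w₀ :+ x :* (t :* c :+ w)
      := (con (+ 1) :+ x :* g) :* w₀ :+ t :* (x :* (g :+ a)) :* u
         :+ x :* (w :- (g :* w₀ :+ t :* a :* u))
         :+ x :* t :* (c :- g :* u))
      (λ _ → refl) X (weight 0 2) (const (+ G 2 2)) (count d) (weight d 2)
      (geometric (suc d)) (arithGeometric d) (count 0))))

-- Closed forms

-- G h₁ h₂ is the contribution of a vertical line between columns of heights h₁ and h₂.  The
-- hypotheses say that column 0 may be given height 1 instead of 0, and that raising the column
-- left of a line from height 1 to 2 adds 1 unless the column on its right has height 2.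
module ClosedForm (K : ℕ) (G : ℕ → ℕ → ℕ)
  (G₀₁ : G 0 1 ≡ G 1 1) (G₀₂ : G 0 2 ≡ G 1 2)
  (G₂₀ : G 2 0 ≡ suc (G 1 0)) (G₂₁ : G 2 1 ≡ suc (G 1 1)) (G₁₂ : G 1 2 ≡ G 2 2) where

  open StateSeries K G

  C U W W₀ : Series
  C  = count K
  U  = count 0
  W  = weight K 1
  W₀ = weight 0 2

  e₁ e₂ f₁ f₂ t₁ t₂ : Series
  e₁ = const (+ G 1 0)
  e₂ = const (+ G 2 0)
  f₁ = const (+ G 1 1)
  f₂ = const (+ G 2 1)
  t₁ = const (+ G 1 2)
  t₂ = const (+ G 2 2)

  z : Series
  z = X^ K

  B : Series
  B = 1ˢ -ˢ const (+ 2) *ˢ X +ˢ X^ (2 ℕ.+ K)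

  -- Starting from height 2 instead of 1 adds 1 exactly for the empty word and words beginning with 0.
  weight₂≈weight₁+count₀ : ∀ d → weight d 2 ≈ˢ weight d 1 +ˢ U
  weight₂≈weight₁+count₀ zero    = ≈ˢ-trans (weight-zero 2)
    (linear-combination 1ˢ (const-suc G₂₀)
    (linear-combination (X *ˢ C) (const-suc G₂₁)
    (linear-combination (-ˢ 1ˢ) (weight-zero 1)
    (linear-combination (-ˢ 1ˢ) count-zero
    (solve 9 (λ x c t e₁ e₂ f₁ f₂ w₁ u →
        e₂ :+ x :* (f₂ :* c :+ t)
      := w₁ :+ u
         :+ con (+ 1) :* (e₂ :- (con (+ 1) :+ e₁))
         :+ x :* c :* (f₂ :- (con (+ 1) :+ f₁))
         :+ (:- con (+ 1)) :* (w₁ :- (e₁ :+ x :* (f₁ :* c :+ t)))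
         :+ (:- con (+ 1)) :* (u :- (con (+ 1) :+ x :* c)))
      (λ _ → refl) X C W e₁ e₂ f₁ f₂ (weight 0 1) U)))))
  weight₂≈weight₁+count₀ (suc d) = ≈ˢ-trans (weight-suc d 2)
    (linear-combination 1ˢ (weight₂≈weight₁+count₀ zero)
    (linear-combination (-ˢ 1ˢ) (weight-suc d 1)
    (linear-combination (-ˢ (X *ˢ count d)) (const-≡ G₁₂)
    (solve 9 (λ x w₀ w₀₁ ws₁ t₁ t₂ c w u →
        w₀ :+ x :* (t₂ :* c :+ w)
      := ws₁ :+ u
         :+ con (+ 1) :* (w₀ :- (w₀₁ :+ u))
         :+ (:- con (+ 1)) :* (ws₁ :- (w₀₁ :+ x :* (t₁ :* c :+ w)))
         :+ (:- (x :* c)) :* (t₁ :- t₂))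
      (λ _ → refl) X W₀ (weight 0 1) (weight (suc d) 1) t₁ t₂ (count d) (weight d 2) U))))

  B*C : B *ˢ C ≈ˢ 1ˢ -ˢ X^ (suc K)
  B*C =
    linear-combination (1ˢ -ˢ X) (count-closed K)
    (linear-combination U (geometric-formula (suc K))
    (linear-combination (1ˢ -ˢ X^ (suc K)) count-zero
    (solve 5 (λ x z c u g →
        (con (+ 1) :- con (+ 2) :* x :+ x :* (x :* z)) :* c
      := con (+ 1) :- x :* z
         :+ (con (+ 1) :- x) :* (c :- g :* u)
         :+ u :* ((con (+ 1) :- x) :* g :- (con (+ 1) :- x :* z))
         :+ (con (+ 1) :- x :* z) :* (u :- (con (+ 1) :+ x :* c)))
      (λ _ → refl) X z C U (geometric (suc K)))))

  B*U : B *ˢ U ≈ˢ 1ˢ -ˢ X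
  B*U =
    linear-combination B count-zero
    (linear-combination X B*C
    (solve 4 (λ x z c u →
        (con (+ 1) :- con (+ 2) :* x :+ x :* (x :* z)) :* u
      := con (+ 1) :- x
         :+ (con (+ 1) :- con (+ 2) :* x :+ x :* (x :* z)) :* (u :- (con (+ 1) :+ x :* c))
         :+ x :* ((con (+ 1) :- con (+ 2) :* x :+ x :* (x :* z)) :* c :- (con (+ 1) :- x :* z)))
      (λ _ → refl) X z C U))

  B*W : B *ˢ W ≈ˢ (1ˢ -ˢ X^ (suc K)) *ˢ (e₂ +ˢ X *ˢ f₂ *ˢ C)
                  +ˢ t₂ *ˢ (X *ˢ geometric K -ˢ const (+ K) *ˢ X *ˢ z) *ˢ U -ˢ (1ˢ -ˢ X) *ˢ U
  B*W =
    linear-combination (1ˢ -ˢ X) (≈ˢ-trans (≈ˢ-sym (weight₂≈weight₁+count₀ K)) (weight₂-closed K))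
    (linear-combination W₀ (geometric-formula (suc K))
    (linear-combination (t₂ *ˢ U) (arithGeometric-formula K)
    (linear-combination (1ˢ -ˢ X^ (suc K)) (weight-zero 2)
    (solve 13 (λ x z c w u w₀ e₂ f₂ t₂ g a gₖ k →
        (con (+ 1) :- con (+ 2) :* x :+ x :* (x :* z)) :* w
      := (con (+ 1) :- x :* z) :* (e₂ :+ x :* f₂ :* c)
         :+ t₂ :* (x :* gₖ :- k :* x :* z) :* u :- (con (+ 1) :- x) :* u
         :+ (con (+ 1) :- x) :* (w :+ u :- (g :* w₀ :+ t₂ :* a :* u))
         :+ w₀ :* ((con (+ 1) :- x) :* g :- (con (+ 1) :- x :* z))
         :+ t₂ :* u :* ((con (+ 1) :- x) :* a :- (x :* gₖ :- k :* x :* z))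
         :+ (con (+ 1) :- x :* z) :* (w₀ :- (e₂ :+ x :* (f₂ :* c :+ w))))
      (λ _ → refl) X z C W U W₀ e₂ f₂ t₂ (geometric (suc K)) (arithGeometric K) (geometric K) (const (+ K))))))

  numerator : Series
  numerator = (1ˢ -ˢ X^ (suc K)) *ˢ (e₂ *ˢ B +ˢ f₂ *ˢ X *ˢ (1ˢ -ˢ X^ (suc K)))
              +ˢ t₂ *ˢ (X *ˢ (1ˢ -ˢ z) -ˢ const (+ K) *ˢ X *ˢ z *ˢ (1ˢ -ˢ X))
              -ˢ (1ˢ -ˢ X) *ˢ (1ˢ -ˢ X)

  B*B*W : B *ˢ B *ˢ W ≈ˢ numerator
  B*B*W =
    linear-combination B B*W
    (linear-combination (X *ˢ f₂ *ˢ (1ˢ -ˢ X^ (suc K))) B*C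
    (linear-combination (t₂ *ˢ (X *ˢ geometric K -ˢ const (+ K) *ˢ X *ˢ z) -ˢ (1ˢ -ˢ X)) B*U
    (linear-combination (t₂ *ˢ X) (geometric-formula K)
    (solve 10 (λ x z c w u e₂ f₂ t₂ gₖ k →
      let b = con (+ 1) :- con (+ 2) :* x :+ x :* (x :* z)
          ρ = con (+ 1) :- x :* z
      in  b :* b :* w
      := ρ :* (e₂ :* b :+ f₂ :* x :* ρ)
         :+ t₂ :* (x :* (con (+ 1) :- z) :- k :* x :* z :* (con (+ 1) :- x))
         :- (con (+ 1) :- x) :* (con (+ 1) :- x)
         :+ b :* (b :* w :- (ρ :* (e₂ :+ x :* f₂ :* c) :+ t₂ :* (x :* gₖ :- k :* x :* z) :* u :- (con (+ 1) :- x) :* u))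
         :+ x :* f₂ :* ρ :* (b :* c :- ρ)
         :+ (t₂ :* (x :* gₖ :- k :* x :* z) :- (con (+ 1) :- x)) :* (b :* u :- (con (+ 1) :- x))
         :+ t₂ :* x :* ((con (+ 1) :- x) :* gₖ :- (con (+ 1) :- z)))
      (λ _ → refl) X z C W U e₂ f₂ t₂ (geometric K) (const (+ K))))))

  pairSum-from-0 : ∀ b w → pairSum G 0 (b ∷ w) ≡ pairSum G 1 (b ∷ w)
  pairSum-from-0 false w = cong (ℕ._+ pairSum G 1 w) G₀₁
  pairSum-from-0 true  w = cong (ℕ._+ pairSum G 2 w) G₀₂

  -- The empty word contributes e₁ to W but nothing to genF.
  genF≈W-e₁ : ∀ stat → (∀ w → stat w ≡ pairSum G 0 w) → genF stat (suc K) ≈ˢ W -ˢ e₁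
  genF≈W-e₁ stat stat≡ zero    = sym (trans (cong (ℤ._- + G 1 0) (acceptedSum-at-zero K (λ w → + pairSum G 1 w))) (ℤₚ.+-inverseʳ (+ G 1 0)))
  genF≈W-e₁ stat stat≡ (suc n) = begin
    + sum (map stat (F (suc n) (suc K)))
      ≡⟨ sumℤ-filter (noKOnes (suc K)) stat (words (suc n)) ⟩
    sumℤ (map φ (words (suc n)))
      ≡⟨ sumℤ-words-suc φ n ⟩
    sumℤ (map (φ ∘ (false ∷_)) (words n)) ℤ.+ sumℤ (map (φ ∘ (true ∷_)) (words n))
      ≡⟨ cong₂ ℤ._+_ (cong sumℤ (map-cong (φ≡ψ false) (words n))) (cong sumℤ (map-cong (φ≡ψ true) (words n))) ⟩
    sumℤ (map (ψ ∘ (false ∷_)) (words n)) ℤ.+ sumℤ (map (ψ ∘ (true ∷_)) (words n))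
      ≡⟨ sym (sumℤ-words-suc ψ n) ⟩
    W (suc n)
      ≡⟨ sym (ℤₚ.+-identityʳ (W (suc n))) ⟩
    (W -ˢ e₁) (suc n) ∎
    where
    open ≡-Reasoning
    φ ψ : List Bool → ℤ
    φ w = if noKOnes (suc K) w then + stat w else + 0
    ψ w = if accepts K K w then + pairSum G 1 w else + 0
    φ≡ψ : ∀ b w → φ (b ∷ w) ≡ ψ (b ∷ w)
    φ≡ψ b w rewrite noKOnes≡accepts K (b ∷ w) | stat≡ (b ∷ w) | pairSum-from-0 b w = refl

  base≈B : base (suc K) ≈ˢ B
  base≈B = ≈ˢ-trans (poly≈polySum ((+ 1 , 0) ∷ (ℤ.- + 2 , 1) ∷ (+ 1 , 2 ℕ.+ K) ∷ []))
    (solve 2 (λ x w → con (+ 1) :* con (+ 1) :+ (con (ℤ.- + 2) :* (x :* con (+ 1)) :+ (con (+ 1) :* w :+ con (+ 0)))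
                    := con (+ 1) :- con (+ 2) :* x :+ w)
       (λ _ → refl) X (X^ (2 ℕ.+ K)))

  den*genF : ∀ stat → (∀ w → stat w ≡ pairSum G 0 w) →
             den (suc K) ⊛ genF stat (suc K) ≈ˢ numerator -ˢ e₁ *ˢ (B *ˢ B)
  den*genF stat stat≡ = ≈ˢ-trans (⊛-cong (⊛-cong base≈B base≈B) (genF≈W-e₁ stat stat≡))
    (linear-combination 1ˢ B*B*W
    (solve 4 (λ b w e n → b :* b :* (w :- e) := n :- e :* (b :* b) :+ con (+ 1) :* (b :* b :* w :- n))
      (λ _ → refl) B W e₁ numerator))

-- The two numerators

module Vertices (K : ℕ) = ClosedForm K verticesAt refl refl refl refl refl
module Edges    (K : ℕ) = ClosedForm K edgesAt refl refl refl refl refl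

numVer≈ : ∀ K → numVer (suc K) ≈ˢ Vertices.numerator K -ˢ Vertices.e₁ K *ˢ (Vertices.B K *ˢ Vertices.B K)
numVer≈ K = ≈ˢ-trans (poly≈polySum terms)
  (linear-combination (X^ (suc K)) (const-affine (ℤ.- + 6) (ℤ.- + 3) K (coeff₁ (+ K)))
  (linear-combination (X^ (2 ℕ.+ K)) (const-affine (ℤ.- + 1) (+ 3) K (coeff₂ (+ K)))
  (linear-combination (const (ℤ.- + 2) *ˢ X^ 3) (X^-+ K (suc K))
  (solve 6 (λ x z k c₁ c₂ w →
    let b = con (+ 1) :- con (+ 2) :* x :+ x :* (x :* z)
        ρ = con (+ 1) :- x :* z
    in  con (+ 10) :* (x :* con (+ 1)) :+ (con (ℤ.- + 9) :* (x :* (x :* con (+ 1)))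
        :+ (c₁ :* (x :* z) :+ (c₂ :* (x :* (x :* z)) :+ (con (+ 8) :* (x :* (x :* (x :* z)))
        :+ (con (ℤ.- + 2) :* (x :* (x :* (x :* w))) :+ con (+ 0))))))
    := ρ :* (con (+ 3) :* b :+ con (+ 3) :* x :* ρ)
       :+ con (+ 3) :* (x :* (con (+ 1) :- z) :- k :* x :* z :* (con (+ 1) :- x))
       :- (con (+ 1) :- x) :* (con (+ 1) :- x)
       :- con (+ 2) :* (b :* b)
       :+ x :* z :* (c₁ :- (con (ℤ.- + 6) :+ con (ℤ.- + 3) :* k))
       :+ x :* (x :* z) :* (c₂ :- (con (ℤ.- + 1) :+ con (+ 3) :* k))
       :+ con (ℤ.- + 2) :* (x :* (x :* (x :* con (+ 1)))) :* (w :- z :* (x :* z)))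
    (λ _ → refl) X (X^ K) (const (+ K)) (const c₁) (const c₂) (X^ (K ℕ.+ suc K))))))
  where
  k : ℕ
  k = suc K
  c₁ c₂ : ℤ
  c₁ = ℤ.- (+ 3 ℤ.* (+ 1 ℤ.+ + k))
  c₂ = ℤ.- (+ 4 ℤ.- + 3 ℤ.* + k)
  terms : List (ℤ × ℕ)
  terms = (+ 10 , 1) ∷ (ℤ.- (+ 9) , 2) ∷ (c₁ , k) ∷ (c₂ , suc k) ∷ (+ 8 , suc (suc k))
          ∷ (ℤ.- (+ 2) , suc (suc (k ℕ.+ k))) ∷ []
  coeff₁ : ∀ κ → ℤ.- (+ 3 ℤ.* (+ 1 ℤ.+ (+ 1 ℤ.+ κ))) ≡ ℤ.- + 6 ℤ.+ ℤ.- + 3 ℤ.* κ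
  coeff₁ = solve-∀
  coeff₂ : ∀ κ → ℤ.- (+ 4 ℤ.- + 3 ℤ.* (+ 1 ℤ.+ κ)) ≡ ℤ.- + 1 ℤ.+ + 3 ℤ.* κ
  coeff₂ = solve-∀

numEdg≈ : ∀ K → numEdg (suc K) ≈ˢ Edges.numerator K -ˢ Edges.e₁ K *ˢ (Edges.B K *ˢ Edges.B K)
numEdg≈ K = ≈ˢ-trans (poly≈polySum terms)
  (linear-combination (X^ (suc K)) (const-affine (ℤ.- + 7) (ℤ.- + 5) K (coeff₁ (+ K)))
  (linear-combination (X^ (2 ℕ.+ K)) (const-affine (ℤ.- + 4) (+ 5) K (coeff₂ (+ K)))
  (linear-combination (const (+ 2) *ˢ X^ 2 -ˢ X^ 3) (X^-+ K (suc K))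
  (solve 6 (λ x z k c₁ c₂ w →
    let b = con (+ 1) :- con (+ 2) :* x :+ x :* (x :* z)
        ρ = con (+ 1) :- x :* z
    in  con (+ 11) :* (x :* con (+ 1)) :+ (con (ℤ.- + 5) :* (x :* (x :* con (+ 1)))
        :+ (c₁ :* (x :* z) :+ (c₂ :* (x :* (x :* z)) :+ (con (+ 4) :* (x :* (x :* (x :* z)))
        :+ (con (+ 2) :* (x :* (x :* w)) :+ (con (ℤ.- + 1) :* (x :* (x :* (x :* w))) :+ con (+ 0)))))))
    := ρ :* (con (+ 2) :* b :+ con (+ 4) :* x :* ρ)
       :+ con (+ 5) :* (x :* (con (+ 1) :- z) :- k :* x :* z :* (con (+ 1) :- x))
       :- (con (+ 1) :- x) :* (con (+ 1) :- x)
       :- con (+ 1) :* (b :* b)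
       :+ x :* z :* (c₁ :- (con (ℤ.- + 7) :+ con (ℤ.- + 5) :* k))
       :+ x :* (x :* z) :* (c₂ :- (con (ℤ.- + 4) :+ con (+ 5) :* k))
       :+ (con (+ 2) :* (x :* (x :* con (+ 1))) :- x :* (x :* (x :* con (+ 1)))) :* (w :- z :* (x :* z)))
    (λ _ → refl) X (X^ K) (const (+ K)) (const c₁) (const c₂) (X^ (K ℕ.+ suc K))))))
  where
  k : ℕ
  k = suc K
  c₁ c₂ : ℤ
  c₁ = ℤ.- (+ 2 ℤ.+ + 5 ℤ.* + k)
  c₂ = ℤ.- (+ 9 ℤ.- + 5 ℤ.* + k)
  terms : List (ℤ × ℕ)
  terms = (+ 11 , 1) ∷ (ℤ.- (+ 5) , 2) ∷ (c₁ , k) ∷ (c₂ , suc k) ∷ (+ 4 , suc (suc k))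
          ∷ (+ 2 , suc (k ℕ.+ k)) ∷ (ℤ.- (+ 1) , suc (suc (k ℕ.+ k))) ∷ []
  coeff₁ : ∀ κ → ℤ.- (+ 2 ℤ.+ + 5 ℤ.* (+ 1 ℤ.+ κ)) ≡ ℤ.- + 7 ℤ.+ ℤ.- + 5 ℤ.* κ
  coeff₁ = solve-∀
  coeff₂ : ∀ κ → ℤ.- (+ 9 ℤ.- + 5 ℤ.* (+ 1 ℤ.+ κ)) ≡ ℤ.- + 4 ℤ.+ + 5 ℤ.* κ
  coeff₂ = solve-∀

corollary2p2 : (k : ℕ) → 2 ≤ k →
    ((n : ℕ) → (den k ⊛ genF ver k) n ≡ numVer k n)
    × ((n : ℕ) → (den k ⊛ genF edg k) n ≡ numEdg k n)
-- The formulas hold for every k ≥ 1; the hypothesis 2 ≤ k is only needed to exclude k = 0.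
corollary2p2 zero    ()
corollary2p2 (suc K) _ =
    ≈ˢ-trans (Vertices.den*genF K ver ver≡pairSum) (≈ˢ-sym (numVer≈ K))
  , ≈ˢ-trans (Edges.den*genF K edg edg≡pairSum) (≈ˢ-sym (numEdg≈ K))
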